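{- Let $G$ be a graph without universal vertices. Then \[ \frac{1}{\gamma_f(G)} + \frac{1}{\Gamma_f(\overline{G})} = 1, \] where $\overline{G}$ is the complement graph of $G$.
   Context: Graphs are finite and simple. A vertex is universal if it is adjacent to all other vertices. For a hypergraph $H=(V,E)$, the fractional transversal number $\tau_f(H)$ is the optimal value of $\min \sum_v x_v$ s.t. $\sum_{v\in e}x_v\ge 1$ for every edge $e$, $x \ge 0$. The fractional dominating number $\gamma_f(G)$ is $\tau_f$ of the hypergraph on $V(G)$ whose edges are the closed neighbourhoods $N[v] = N(v)\cup\{v\}$, $v\in V(G)$; the fractional total dominating number $\Gamma_f(G)$ is $\tau_f$ of the hypergraph on $V(G)$ whose edges are the open neighbourhoods $N(v)$, $v\in V(G)$.
   Formalization: The vectors x in the linear program defining the fractional transversal number $\tau_f(H)$ have rational entries rather than real ones. -}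

module Defs where

open import Data.Nat using (ℕ; zero; suc)
open import Data.Fin using (Fin; zero; suc)
open import Data.Bool using (Bool; true; false; if_then_else_; not; _∨_)
open import Data.Rational using (ℚ; 0ℚ; 1ℚ; _+_; _≤_)
open import Data.Product using (Σ; _×_)
open import Relation.Binary.PropositionalEquality using (_≡_)
open import Relation.Nullary using (¬_)
open import Data.Fin using (_≟_)
open import Relation.Nullary.Decidable using (⌊_⌋)

record Graph (n : ℕ) : Set where
  field
    adj     : Fin n → Fin n → Bool
    adj-sym : ∀ u v → adj u v ≡ adj v u
    adj-irrefl : ∀ v → adj v v ≡ false
open Graph public

complement : ∀ {n} → Graph n → Graph n
complement {n} G = record
  { adj = λ u v → if ⌊ u ≟ v ⌋ then false else not (adj G u v)
  ; adj-sym = symC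
  ; adj-irrefl = irC }
  where
  open import Relation.Binary.PropositionalEquality using (refl; sym; cong)
  open import Relation.Nullary using (yes; no)
  symC : ∀ u v → (if ⌊ u ≟ v ⌋ then false else not (adj G u v))
               ≡ (if ⌊ v ≟ u ⌋ then false else not (adj G v u))
  symC u v with u ≟ v | v ≟ u
  ... | yes _ | yes _ = refl
  ... | yes p | no ¬q = Data.Empty.⊥-elim (¬q (sym p)) where import Data.Empty
  ... | no ¬p | yes q = Data.Empty.⊥-elim (¬p (sym q)) where import Data.Empty
  ... | no _ | no _ = cong not (adj-sym G u v)
  irC : ∀ v → (if ⌊ v ≟ v ⌋ then false else not (adj G v v)) ≡ false
  irC v with v ≟ v
  ... | yes _ = refl
  ... | no ¬p = Data.Empty.⊥-elim (¬p refl) where import Data.Empty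

Universal : ∀ {n} → Graph n → Fin n → Set
Universal G v = ∀ u → ¬ (u ≡ v) → adj G v u ≡ true

-- A hypergraph on Fin n whose edges are indexed by Fin m;
-- H e v = true  iff  v ∈ e.
Hypergraph : ℕ → ℕ → Set
Hypergraph n m = Fin m → Fin n → Bool

sumFin : ∀ {n} → (Fin n → ℚ) → ℚ
sumFin {zero}  f = 0ℚ
sumFin {suc n} f = f zero + sumFin (λ i → f (suc i))

edgeWeight : ∀ {n} → (Fin n → Bool) → (Fin n → ℚ) → ℚ
edgeWeight e x = sumFin (λ v → if e v then x v else 0ℚ)

FractionalTransversal : ∀ {n m} → Hypergraph n m → (Fin n → ℚ) → Set
FractionalTransversal H x = (∀ v → 0ℚ ≤ x v) × (∀ e → 1ℚ ≤ edgeWeight (H e) x)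

IsTauF : ∀ {n m} → Hypergraph n m → ℚ → Set
IsTauF H t =
  Σ _ (λ x → FractionalTransversal H x × sumFin x ≡ t)
  × (∀ x → FractionalTransversal H x → t ≤ sumFin x)

closedNbhd : ∀ {n} → Graph n → Hypergraph n n
closedNbhd G v u = ⌊ u ≟ v ⌋ ∨ adj G v u

openNbhd : ∀ {n} → Graph n → Hypergraph n n
openNbhd G v u = adj G v u

IsFracDom : ∀ {n} → Graph n → ℚ → Set
IsFracDom G = IsTauF (closedNbhd G)

IsFracTotalDom : ∀ {n} → Graph n → ℚ → Set
IsFracTotalDom G = IsTauF (openNbhd G)

-- γ_f(G) is the value of the linear program  min Σ x  subject to  A x ≥ 1, x ≥ 0,  where
-- A = I + adj(G) is symmetric with unit diagonal; by strong duality (obtained here from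
-- Fourier–Motzkin elimination) the packing program  max Σ z  subject to  A z ≤ 1, z ≥ 0
-- has the same value a.  The open neighbourhoods of the complement have incidence matrix
-- J − A.  Weighting the constraints (J − A) y ≥ 1 by an optimal x and using the symmetry
-- of A gives (a − 1) Σ y ≥ a for every feasible y, while z / (a − 1) is feasible with
-- value a / (a − 1); hence Γ_f(Ḡ) = a / (a − 1) and 1/a + 1/Γ_f(Ḡ) = 1.  Without
-- universal vertices a > 1: if a ≤ 1, a vertex carrying positive weight in x would have
-- to lie in every closed neighbourhood.
module Submission where

open import Defs
open import Algebra.Bundles using (CommutativeMonoid; CommutativeRing)
open import Data.Bool using (Bool; true; false; not; if_then_else_)
open import Data.Empty using (⊥; ⊥-elim)
open import Data.Fin using (Fin; zero; suc; _↑ˡ_; _↑ʳ_; _≟_)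
open import Data.List using (List; []; _∷_; _++_; map; tabulate; cartesianProductWith)
open import Data.List.Relation.Unary.All as All using (All; []; _∷_)
import Data.List.Relation.Unary.All.Properties as All
open import Data.Nat using (ℕ; zero; suc) renaming (_+_ to _+ℕ_)
open import Data.Product using (Σ; ∃; _×_; _,_; proj₁; proj₂)
open import Data.Rational
  using (ℚ; NonZero; 1/_; _+_; _*_; -_; _-_; _≤_; _<_; 0ℚ; 1ℚ; positive; nonNegative)
open import Data.Rational.Properties hiding (_≟_)
open import Data.Rational.Solver using (module +-*-Solver)
open import Data.Sum using (_⊎_; inj₁; inj₂)
open import Data.Vec.Functional using (Vector)
import Data.Vec.Functional as V
open import Data.Vec.Functional.Properties using (lookup-++ˡ; lookup-++ʳ)
open import Function using (_∘_)
open import Relation.Binary.Bundles using (DecTotalOrder)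
open import Relation.Binary.Definitions using (tri<; tri≈; tri>)
open import Relation.Binary.PropositionalEquality
open import Relation.Nullary using (¬_; yes; no; does; contradiction)

open import Algebra.Properties.Semiring.Sum (CommutativeRing.semiring +-*-commutativeRing)
  using (sum; sum-cong-≗; ∑-distrib-+; ∑-comm; *-distribˡ-sum; sum-replicate-zero)
open import Algebra.Properties.CommutativeSemigroup
  (CommutativeMonoid.commutativeSemigroup +-0-commutativeMonoid) using (interchange)
open import Algebra.Properties.Group +-0-group using (⁻¹-involutive)
open import Data.List.Extrema (DecTotalOrder.totalOrder ≤-decTotalOrder)
  using (max; min; xs≤max; min≤xs; max≤v⁺)
open +-*-Solver

-- Arithmetic, finite sums and dot products over ℚ

*-monoˡ-≤-≥0 : ∀ {r p q} → 0ℚ ≤ r → p ≤ q → r * p ≤ r * q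
*-monoˡ-≤-≥0 {r} 0≤r = *-monoˡ-≤-nonNeg r {{nonNegative 0≤r}}

*-nonNeg : ∀ {p q} → 0ℚ ≤ p → 0ℚ ≤ q → 0ℚ ≤ p * q
*-nonNeg {p} {q} 0≤p 0≤q =
  nonNegative⁻¹ (p * q) {{nonNeg*nonNeg⇒nonNeg p {{nonNegative 0≤p}} q {{nonNegative 0≤q}}}}

neg-cancel-≤ : ∀ {p q} → - p ≤ - q → q ≤ p
neg-cancel-≤ {p} {q} -p≤-q = subst₂ _≤_ (⁻¹-involutive q) (⁻¹-involutive p) (neg-antimono-≤ -p≤-q)

p-q≤0⇒p≤q : ∀ {p q} → p - q ≤ 0ℚ → p ≤ q
p-q≤0⇒p≤q {p} {q} p-q≤0 = begin
  p             ≡⟨ solve 2 (λ p q → p := (p :- q) :+ q) refl p q ⟩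
  (p - q) + q   ≤⟨ +-monoˡ-≤ q p-q≤0 ⟩
  0ℚ + q        ≡⟨ +-identityˡ q ⟩
  q             ∎
  where open ≤-Reasoning

positive-inverse : ∀ {k} → 0ℚ < k → ∃ λ q → 0ℚ < q × q * k ≡ 1ℚ
positive-inverse {k} 0<k = 1/ k , positive⁻¹ (1/ k) {{1/pos⇒pos k}} , *-inverseˡ k
  where
  instance
    _ = positive 0<k
    _ = pos⇒nonZero k

sumFin≡sum : ∀ {n} (f : Vector ℚ n) → sumFin f ≡ sum f
sumFin≡sum {zero}  f = refl
sumFin≡sum {suc n} f = cong (f zero +_) (sumFin≡sum (f ∘ suc))

sumFin-cong : ∀ {n} {f g : Vector ℚ n} → f ≗ g → sumFin f ≡ sumFin g
sumFin-cong {f = f} {g} f≗g = trans (sumFin≡sum f) (trans (sum-cong-≗ f≗g) (sym (sumFin≡sum g)))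

sumFin-+ : ∀ {n} (f g : Vector ℚ n) → sumFin (λ i → f i + g i) ≡ sumFin f + sumFin g
sumFin-+ f g = trans (sumFin≡sum (λ i → f i + g i))
  (trans (∑-distrib-+ f g) (sym (cong₂ _+_ (sumFin≡sum f) (sumFin≡sum g))))

*-distribˡ-sumFin : ∀ {n} q (f : Vector ℚ n) → sumFin (λ i → q * f i) ≡ q * sumFin f
*-distribˡ-sumFin q f = trans (sumFin≡sum (λ i → q * f i))
  (trans (sym (*-distribˡ-sum q f)) (cong (q *_) (sym (sumFin≡sum f))))

sumFin-comm : ∀ {m n} (f : Fin m → Fin n → ℚ) →
  sumFin (λ i → sumFin (f i)) ≡ sumFin (λ j → sumFin (λ i → f i j))
sumFin-comm f = begin
  sumFin (λ i → sumFin (f i))          ≡⟨ sumFin≡sum (λ i → sumFin (f i)) ⟩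
  sum (λ i → sumFin (f i))             ≡⟨ sum-cong-≗ (λ i → sumFin≡sum (f i)) ⟩
  sum (λ i → sum (f i))                ≡⟨ ∑-comm f ⟩
  sum (λ j → sum (λ i → f i j))        ≡⟨ sum-cong-≗ (λ j → sym (sumFin≡sum (λ i → f i j))) ⟩
  sum (λ j → sumFin (λ i → f i j))     ≡⟨ sym (sumFin≡sum (λ j → sumFin (λ i → f i j))) ⟩
  sumFin (λ j → sumFin (λ i → f i j))  ∎
  where open ≡-Reasoning

sumFin-zeros : ∀ {n} → sumFin {n} (λ _ → 0ℚ) ≡ 0ℚ
sumFin-zeros {n} = trans (sumFin≡sum {n} (λ _ → 0ℚ)) (sum-replicate-zero n)

sumFin-neg : ∀ {n} (f : Vector ℚ n) → sumFin (λ i → - f i) ≡ - sumFin f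
sumFin-neg {zero}  f = refl
sumFin-neg {suc n} f =
  trans (cong (- f zero +_) (sumFin-neg (f ∘ suc))) (sym (neg-distrib-+ (f zero) _))

sumFin-↑ : ∀ m {n} (f : Vector ℚ (m +ℕ n)) →
  sumFin f ≡ sumFin (f ∘ (_↑ˡ n)) + sumFin (f ∘ (m ↑ʳ_))
sumFin-↑ zero    f = sym (+-identityˡ _)
sumFin-↑ (suc m) f = trans (cong (f zero +_) (sumFin-↑ m (f ∘ suc))) (sym (+-assoc (f zero) _ _))

sumFin-mono : ∀ {n} {f g : Vector ℚ n} → (∀ i → f i ≤ g i) → sumFin f ≤ sumFin g
sumFin-mono {zero}  f≤g = ≤-refl
sumFin-mono {suc n} f≤g = +-mono-≤ (f≤g zero) (sumFin-mono (f≤g ∘ suc))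

sumFin-nonNeg : ∀ {n} {f : Vector ℚ n} → (∀ i → 0ℚ ≤ f i) → 0ℚ ≤ sumFin f
sumFin-nonNeg {n} 0≤f = ≤-trans (≤-reflexive (sym (sumFin-zeros {n}))) (sumFin-mono 0≤f)

term≤sumFin : ∀ {n} {f : Vector ℚ n} → (∀ i → 0ℚ ≤ f i) → ∀ i → f i ≤ sumFin f
term≤sumFin {suc n} {f} 0≤f zero = ≤-trans (≤-reflexive (sym (+-identityʳ (f zero))))
  (+-monoʳ-≤ (f zero) (sumFin-nonNeg (0≤f ∘ suc)))
term≤sumFin {suc n} {f} 0≤f (suc i) = ≤-trans (≤-reflexive (sym (+-identityˡ (f (suc i)))))
  (+-mono-≤ (0≤f zero) (term≤sumFin (0≤f ∘ suc) i))

∃-positive-term : ∀ {n} (f : Vector ℚ n) → 0ℚ < sumFin f → ∃ λ i → 0ℚ < f i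
∃-positive-term {zero}  f 0<0 = contradiction 0<0 (<-irrefl refl)
∃-positive-term {suc n} f 0<Σf with 0ℚ <? f zero
... | yes 0<f₀ = zero , 0<f₀
... | no  0≮f₀ = let i , 0<fᵢ = ∃-positive-term (f ∘ suc) 0<Σtail in suc i , 0<fᵢ
  where
  0<Σtail : 0ℚ < sumFin (f ∘ suc)
  0<Σtail = <-≤-trans 0<Σf
    (≤-trans (+-monoˡ-≤ (sumFin (f ∘ suc)) (≮⇒≥ 0≮f₀)) (≤-reflexive (+-identityˡ _)))

_·_ : ∀ {n} → Vector ℚ n → Vector ℚ n → ℚ
a · x = sumFin (λ i → a i * x i)

𝟙 : Bool → ℚ
𝟙 b = if b then 1ℚ else 0ℚ

δ : ∀ {n} → Fin n → Vector ℚ n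
δ i j = 𝟙 (does (j ≟ i))

zeros ones : ∀ {n} → Vector ℚ n
zeros _ = 0ℚ
ones  _ = 1ℚ

neg : ∀ {n} → Vector ℚ n → Vector ℚ n
neg a i = - a i

·-comm : ∀ {n} (a x : Vector ℚ n) → a · x ≡ x · a
·-comm a x = sumFin-cong (λ i → *-comm (a i) (x i))

·-distribʳ-+ : ∀ {n} (a b x : Vector ℚ n) → (λ i → a i + b i) · x ≡ a · x + b · x
·-distribʳ-+ a b x = trans (sumFin-cong (λ i → *-distribʳ-+ (x i) (a i) (b i)))
  (sumFin-+ (λ i → a i * x i) (λ i → b i * x i))

·-distribˡ-+ : ∀ {n} (a x y : Vector ℚ n) → a · (λ i → x i + y i) ≡ a · x + a · y
·-distribˡ-+ a x y = trans (sumFin-cong (λ i → *-distribˡ-+ (a i) (x i) (y i)))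
  (sumFin-+ (λ i → a i * x i) (λ i → a i * y i))

·-scaleˡ : ∀ {n} q (a x : Vector ℚ n) → (λ i → q * a i) · x ≡ q * (a · x)
·-scaleˡ q a x =
  trans (sumFin-cong (λ i → *-assoc q (a i) (x i))) (*-distribˡ-sumFin q (λ i → a i * x i))

·-scaleʳ : ∀ {n} q (a x : Vector ℚ n) → a · (λ i → q * x i) ≡ q * (a · x)
·-scaleʳ q a x =
  trans (·-comm a (λ i → q * x i)) (trans (·-scaleˡ q x a) (cong (q *_) (·-comm x a)))

·-neg : ∀ {n} (a x : Vector ℚ n) → neg a · x ≡ - (a · x)
·-neg a x =
  trans (sumFin-cong (λ i → sym (neg-distribˡ-* (a i) (x i)))) (sumFin-neg (λ i → a i * x i))

zeros· : ∀ {n} (x : Vector ℚ n) → zeros · x ≡ 0ℚ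
zeros· {n} x = trans (sumFin-cong (λ i → *-zeroˡ (x i))) (sumFin-zeros {n})

·zeros : ∀ {n} (a : Vector ℚ n) → a · zeros ≡ 0ℚ
·zeros a = trans (·-comm a zeros) (zeros· a)

ones· : ∀ {n} (x : Vector ℚ n) → ones · x ≡ sumFin x
ones· x = sumFin-cong (λ i → *-identityˡ (x i))

·-const-minus : ∀ {n} (x g : Vector ℚ n) s → x · (λ v → s - g v) ≡ s * sumFin x - x · g
·-const-minus x g s = begin
  sumFin (λ v → x v * (s - g v))
    ≡⟨ sumFin-cong (λ v → solve 3 (λ x s g → x :* (s :- g) := s :* x :+ :- (x :* g)) refl (x v) s (g v)) ⟩
  sumFin (λ v → s * x v + - (x v * g v))
    ≡⟨ sumFin-+ (λ v → s * x v) (λ v → - (x v * g v)) ⟩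
  sumFin (λ v → s * x v) + sumFin (λ v → - (x v * g v))
    ≡⟨ cong₂ _+_ (*-distribˡ-sumFin s x) (sumFin-neg (λ v → x v * g v)) ⟩
  s * sumFin x - x · g
    ∎
  where open ≡-Reasoning

δ· : ∀ {n} (i : Fin n) (x : Vector ℚ n) → δ i · x ≡ x i
δ· {suc n} zero    x = trans (cong₂ _+_ (*-identityˡ (x zero)) (zeros· (x ∘ suc))) (+-identityʳ _)
δ· {suc n} (suc i) x = trans (cong₂ _+_ (*-zeroˡ (x zero)) (δ· i (λ j → x (suc j)))) (+-identityˡ _)

sumFin-δ : ∀ {n} (i : Fin n) → sumFin (δ i) ≡ 1ℚ
sumFin-δ i = trans (sumFin-cong (λ j → sym (*-identityʳ (δ i j)))) (δ· i ones)

δ-nonNeg : ∀ {n} (i j : Fin n) → 0ℚ ≤ δ i j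
δ-nonNeg i j with does (j ≟ i)
... | true  = <⇒≤ (positive⁻¹ 1ℚ)
... | false = ≤-refl

·-++ : ∀ {m n} (a : Vector ℚ m) (b : Vector ℚ n) (x : Vector ℚ (m +ℕ n)) →
  (a V.++ b) · x ≡ a · (x ∘ (_↑ˡ n)) + b · (x ∘ (m ↑ʳ_))
·-++ {m} {n} a b x = trans (sumFin-↑ m _) (cong₂ _+_
  (sumFin-cong (λ i → cong (_* x (i ↑ˡ n)) (lookup-++ˡ a b i)))
  (sumFin-cong (λ j → cong (_* x (m ↑ʳ j)) (lookup-++ʳ a b j))))

-- Fourier–Motzkin elimination

infix 4 _≤ᵢ_

record Ineq (N : ℕ) : Set where
  constructor _≤ᵢ_
  field
    coeffs : Vector ℚ N
    bound  : ℚ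
open Ineq

Holds : ∀ {N} → Vector ℚ N → Ineq N → Set
Holds x c = coeffs c · x ≤ bound c

_⊕_ : ∀ {N} → Ineq N → Ineq N → Ineq N
c ⊕ d = (λ i → coeffs c i + coeffs d i) ≤ᵢ (bound c + bound d)

_⊛_ : ∀ {N} → ℚ → Ineq N → Ineq N
q ⊛ c = (λ i → q * coeffs c i) ≤ᵢ (q * bound c)

infixr 5 _▸_
_▸_ : ∀ {N} → ℚ → Ineq N → Ineq (suc N)
s ▸ c = (s V.∷ coeffs c) ≤ᵢ bound c

tail : ∀ {N} → Ineq (suc N) → Ineq N
tail c = (coeffs c ∘ suc) ≤ᵢ bound c

record ClosedUnderInference {N} (P : Ineq N → Set) : Set where
  field
    ⊕-closed : ∀ {c d} → P c → P d → P (c ⊕ d)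
    ⊛-closed : ∀ {q c} → 0ℚ ≤ q → P c → P (q ⊛ c)
    weaken   : ∀ {c d} → coeffs c ≗ coeffs d → bound c ≤ bound d → P c → P d
open ClosedUnderInference

Feasible : ∀ {N} → List (Ineq N) → Set
Feasible S = ∃ λ x → All (Holds x) S

-- A Farkas certificate: 0 ≤ β < 0 is derivable from S by nonnegative combinations and
-- weakening.  Derivability is expressed as membership in every predicate closed under
-- these rules, which avoids a syntax of derivations.
Refutable : ∀ {N} → List (Ineq N) → Set₁
Refutable S = ∃ λ β → β < 0ℚ × (∀ P → ClosedUnderInference P → All P S → P (zeros ≤ᵢ β))

Holds-≗ : ∀ {N} {x : Vector ℚ N} {a b β} → a ≗ b → Holds x (a ≤ᵢ β) → Holds x (b ≤ᵢ β)
Holds-≗ a≗b = ≤-trans (≤-reflexive (sumFin-cong (λ i → cong (_* _) (sym (a≗b i)))))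

Holds-⊛ : ∀ {N} {x : Vector ℚ N} {q c} → 0ℚ < q → Holds x (q ⊛ c) → Holds x c
Holds-⊛ {x = x} {q} {c} 0<q h =
  *-cancelˡ-≤-pos q {{positive 0<q}} (≤-trans (≤-reflexive (sym (·-scaleˡ q (coeffs c) x))) h)

Holds-▸0 : ∀ {N} {x : Vector ℚ N} {x₀ c} → Holds x c → Holds (x₀ V.∷ x) (0ℚ ▸ c)
Holds-▸0 {x = x} {x₀} {c} =
  ≤-trans (≤-reflexive (trans (cong (_+ coeffs c · x) (*-zeroˡ x₀)) (+-identityˡ (coeffs c · x))))

▸-tail : ∀ {N} {c : Ineq (suc N)} {s} → coeffs c zero ≡ s → coeffs (s ▸ tail c) ≗ coeffs c
▸-tail c₀≡s zero    = sym c₀≡s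
▸-tail c₀≡s (suc i) = refl

▸0-closed : ∀ {N} {P : Ineq (suc N) → Set} →
  ClosedUnderInference P → ClosedUnderInference (P ∘ (0ℚ ▸_))
▸0-closed cl = record
  { ⊕-closed = λ pc pd →
      weaken cl (λ { zero → +-identityˡ 0ℚ ; (suc i) → refl }) ≤-refl (⊕-closed cl pc pd)
  ; ⊛-closed = λ {q} 0≤q pc →
      weaken cl (λ { zero → *-zeroʳ q ; (suc i) → refl }) ≤-refl (⊛-closed cl 0≤q pc)
  ; weaken   = λ c≗d b≤b′ → weaken cl (λ { zero → refl ; (suc i) → c≗d i }) b≤b′
  }

-- After scaling, every constraint of S has first coefficient 0, 1 or −1; those with 1
-- bound x₀ from above, those with −1 from below.
record Elimination {N} (S : List (Ineq (suc N))) : Set₁ where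
  field
    free upper lower : List (Ineq N)
    derive : ∀ P → ClosedUnderInference P → All P S →
      All (P ∘ (0ℚ ▸_)) free × All (P ∘ (1ℚ ▸_)) upper × All (P ∘ (- 1ℚ ▸_)) lower
    lift : ∀ x₀ x → All (Holds x) free → All (Holds (x₀ V.∷ x) ∘ (1ℚ ▸_)) upper →
      All (Holds (x₀ V.∷ x) ∘ (- 1ℚ ▸_)) lower → All (Holds (x₀ V.∷ x)) S
open Elimination

normalise-derive : ∀ {N} {P : Ineq (suc N) → Set} {c q s} → ClosedUnderInference P →
  0ℚ ≤ q → q * coeffs c zero ≡ s → P c → P (s ▸ tail (q ⊛ c))
normalise-derive {c = c} {q} cl 0≤q qc₀≡s pc =
  weaken cl (λ i → sym (▸-tail {c = q ⊛ c} qc₀≡s i)) ≤-refl (⊛-closed cl 0≤q pc)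

normalise-lift : ∀ {N} (c : Ineq (suc N)) (y : Vector ℚ (suc N)) {q s} →
  0ℚ < q → q * coeffs c zero ≡ s → Holds y (s ▸ tail (q ⊛ c)) → Holds y c
normalise-lift c y {q} 0<q qc₀≡s h =
  Holds-⊛ {x = y} {q} {c} 0<q (Holds-≗ {x = y} {b = coeffs (q ⊛ c)} (▸-tail {c = q ⊛ c} qc₀≡s) h)

eliminate₁ : ∀ {N} (c : Ineq (suc N)) → Elimination (c ∷ [])
eliminate₁ c with <-cmp (coeffs c zero) 0ℚ
... | tri≈ _ c₀≡0 _ = record
  { free = tail (1ℚ ⊛ c) ∷ [] ; upper = [] ; lower = []
  ; derive = λ { P cl (pc ∷ []) → normalise-derive cl (<⇒≤ 0<1) 1c₀≡0 pc ∷ [] , [] , [] }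
  ; lift   = λ { x₀ x (h ∷ []) [] [] →
      normalise-lift c (x₀ V.∷ x) 0<1 1c₀≡0 (Holds-▸0 {x = x} {x₀} {tail (1ℚ ⊛ c)} h) ∷ [] }
  }
  where
  0<1 = positive⁻¹ 1ℚ
  1c₀≡0 = trans (*-identityˡ (coeffs c zero)) c₀≡0
... | tri> _ _ 0<c₀ with positive-inverse 0<c₀
...   | q , 0<q , qc₀≡1 = record
  { free = [] ; upper = tail (q ⊛ c) ∷ [] ; lower = []
  ; derive = λ { P cl (pc ∷ []) → [] , normalise-derive cl (<⇒≤ 0<q) qc₀≡1 pc ∷ [] , [] }
  ; lift   = λ { x₀ x [] (h ∷ []) [] → normalise-lift c (x₀ V.∷ x) 0<q qc₀≡1 h ∷ [] }
  }
eliminate₁ c | tri< c₀<0 _ _ with positive-inverse (neg-antimono-< c₀<0)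
...   | q , 0<q , q[-c₀]≡1 = record
  { free = [] ; upper = [] ; lower = tail (q ⊛ c) ∷ []
  ; derive = λ { P cl (pc ∷ []) → [] , [] , normalise-derive cl (<⇒≤ 0<q) qc₀≡-1 pc ∷ [] }
  ; lift   = λ { x₀ x [] [] (h ∷ []) → normalise-lift c (x₀ V.∷ x) 0<q qc₀≡-1 h ∷ [] }
  }
  where
  c₀ = coeffs c zero
  qc₀≡-1 : q * c₀ ≡ - 1ℚ
  qc₀≡-1 = trans (solve 2 (λ q c → q :* c := :- (q :* (:- c))) refl q c₀) (cong -_ q[-c₀]≡1)

∅ᴱ : ∀ {N} → Elimination {N} []
∅ᴱ = record
  { free = [] ; upper = [] ; lower = []
  ; derive = λ _ _ _ → [] , [] , [] ; lift = λ _ _ _ _ _ → [] }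

_∪ᴱ_ : ∀ {N} {S T : List (Ineq (suc N))} → Elimination S → Elimination T → Elimination (S ++ T)
_∪ᴱ_ {S = S} E F = record
  { free = free E ++ free F ; upper = upper E ++ upper F ; lower = lower E ++ lower F
  ; derive = derives
  ; lift = λ x₀ x hf hu hl → All.++⁺
      (lift E x₀ x (All.++⁻ˡ (free E) hf) (All.++⁻ˡ (upper E) hu) (All.++⁻ˡ (lower E) hl))
      (lift F x₀ x (All.++⁻ʳ (free E) hf) (All.++⁻ʳ (upper E) hu) (All.++⁻ʳ (lower E) hl))
  }
  where
  derives : ∀ P → ClosedUnderInference P → All P (S ++ _) → _
  derives P cl hs with derive E P cl (All.++⁻ˡ S hs) | derive F P cl (All.++⁻ʳ S hs)
  ... | fE , uE , lE | fF , uF , lF = All.++⁺ fE fF , All.++⁺ uE uF , All.++⁺ lE lF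

eliminate : ∀ {N} (S : List (Ineq (suc N))) → Elimination S
eliminate []      = ∅ᴱ
eliminate (c ∷ S) = eliminate₁ c ∪ᴱ eliminate S

All-cartesianProductWith⁺ : ∀ {A B C : Set} {P : C → Set} (f : A → B → C) xs ys →
  All (λ x → All (λ y → P (f x y)) ys) xs → All P (cartesianProductWith f xs ys)
All-cartesianProductWith⁺ f []       ys []         = []
All-cartesianProductWith⁺ f (x ∷ xs) ys (hx ∷ hxs) =
  All.++⁺ (All.map⁺ hx) (All-cartesianProductWith⁺ f xs ys hxs)

All-cartesianProductWith⁻ : ∀ {A B C : Set} {P : C → Set} (f : A → B → C) xs ys →
  All P (cartesianProductWith f xs ys) → All (λ x → All (λ y → P (f x y)) ys) xs
All-cartesianProductWith⁻ f []       ys h = []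
All-cartesianProductWith⁻ f (x ∷ xs) ys h =
  All.map⁻ (All.++⁻ˡ (map (f x) ys) h) ∷ All-cartesianProductWith⁻ f xs ys (All.++⁻ʳ (map (f x) ys) h)

-- The witness max (min 0 U) L also covers the cases of an empty L or U.
separation : (L U : List ℚ) → All (λ u → All (_≤ u) L) U → ∃ λ x → All (_≤ x) L × All (x ≤_) U
separation L U L≤U = max (min 0ℚ U) L , xs≤max _ L ,
  All.zipWith (λ (m≤u , L≤u) → max≤v⁺ m≤u L≤u) (min≤xs 0ℚ U , L≤U)

residual : ∀ {N} {S : List (Ineq (suc N))} → Elimination S → List (Ineq N)
residual E = free E ++ cartesianProductWith _⊕_ (upper E) (lower E)

refutation-lifts : ∀ {N} {S : List (Ineq (suc N))} (E : Elimination S) →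
  Refutable (residual E) → Refutable S
refutation-lifts E (β , β<0 , refutes) = β , β<0 , λ P cl hs → derivation P cl (derive E P cl hs)
  where
  pair : ∀ {P : Ineq _ → Set} → ClosedUnderInference P → ∀ {p n} →
    P (1ℚ ▸ p) → P (- 1ℚ ▸ n) → P (0ℚ ▸ (p ⊕ n))
  pair cl pp pn =
    weaken cl (λ { zero → +-inverseʳ 1ℚ ; (suc i) → refl }) ≤-refl (⊕-closed cl pp pn)
  derivation : ∀ P → ClosedUnderInference P → _ → P (zeros ≤ᵢ β)
  derivation P cl (hf , hu , hl) = weaken cl (λ { zero → refl ; (suc i) → refl }) ≤-refl
    (refutes (P ∘ (0ℚ ▸_)) (▸0-closed cl) (All.++⁺ hf
      (All-cartesianProductWith⁺ _⊕_ (upper E) (lower E) (All.map (λ pp → All.map (pair cl pp) hl) hu))))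

feasibility-lifts : ∀ {N} {S : List (Ineq (suc N))} (E : Elimination S) →
  Feasible (residual E) → Feasible S
feasibility-lifts {N} E (x , hs) =
  x₀ V.∷ x , lift E x₀ x (All.++⁻ˡ (free E) hs)
    (All.map (λ {p} → below-upper {p}) x₀≤U) (All.map (λ {n} → above-lower {n}) L≤x₀)
  where
  open ≤-Reasoning
  lowerBound upperBound : Ineq N → ℚ
  lowerBound n = coeffs n · x - bound n
  upperBound p = bound p - coeffs p · x

  separates : ∀ {p n} → Holds x (p ⊕ n) → lowerBound n ≤ upperBound p
  separates {p} {n} h = begin
    b - d                           ≡⟨ solve 4 (λ a b c d → b :- d := (a :+ b) :+ (:- a :- d)) refl a b c d ⟩
    (a + b) + (- a - d)             ≡⟨ cong (_+ (- a - d)) (sym (·-distribʳ-+ (coeffs p) (coeffs n) x)) ⟩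
    coeffs (p ⊕ n) · x + (- a - d)  ≤⟨ +-monoˡ-≤ (- a - d) h ⟩
    (c + d) + (- a - d)             ≡⟨ solve 4 (λ a b c d → (c :+ d) :+ (:- a :- d) := c :- a) refl a b c d ⟩
    c - a                           ∎
    where
    a = coeffs p · x
    b = coeffs n · x
    c = bound p
    d = bound n

  pairs : All (λ p → All (λ n → Holds x (p ⊕ n)) (lower E)) (upper E)
  pairs = All-cartesianProductWith⁻ _⊕_ (upper E) (lower E) (All.++⁻ʳ (free E) hs)

  interval = separation (map lowerBound (lower E)) (map upperBound (upper E))
    (All.map⁺ (All.map (λ {p} hp → All.map⁺ (All.map (λ {n} → separates {p} {n}) hp)) pairs))
  x₀ = proj₁ interval
  L≤x₀ = All.map⁻ (proj₁ (proj₂ interval))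
  x₀≤U = All.map⁻ (proj₂ (proj₂ interval))

  below-upper : ∀ {p} → x₀ ≤ upperBound p → Holds (x₀ V.∷ x) (1ℚ ▸ p)
  below-upper {p} h = begin
    1ℚ * x₀ + t   ≡⟨ cong (_+ t) (*-identityˡ x₀) ⟩
    x₀ + t        ≤⟨ +-monoˡ-≤ t h ⟩
    (b - t) + t   ≡⟨ solve 2 (λ b t → (b :- t) :+ t := b) refl b t ⟩
    b             ∎
    where
    t = coeffs p · x
    b = bound p

  above-lower : ∀ {n} → lowerBound n ≤ x₀ → Holds (x₀ V.∷ x) (- 1ℚ ▸ n)
  above-lower {n} h = begin
    - 1ℚ * x₀ + t
      ≡⟨ solve 3 (λ x₀ t b → con (- 1ℚ) :* x₀ :+ t := (t :- b) :+ (b :- x₀)) refl x₀ t b ⟩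
    (t - b) + (b - x₀)  ≤⟨ +-monoˡ-≤ (b - x₀) h ⟩
    x₀ + (b - x₀)       ≡⟨ solve 2 (λ x₀ b → x₀ :+ (b :- x₀) := b) refl x₀ b ⟩
    b                   ∎
    where
    t = coeffs n · x
    b = bound n

-- Without variables, Holds x c is 0 ≤ bound c by computation.
decide₀ : (S : List (Ineq 0)) → Feasible S ⊎ Refutable S
decide₀ [] = inj₁ ((λ ()) , [])
decide₀ (c ∷ S) with 0ℚ ≤? bound c | decide₀ S
... | no 0≰b  | _             = inj₂ (bound c , ≰⇒> 0≰b , λ { P cl (pc ∷ _) → weaken cl (λ ()) ≤-refl pc })
... | yes 0≤b | inj₁ (x , hs) = inj₁ (x , 0≤b ∷ hs)
... | yes _   | inj₂ (β , β<0 , refutes) = inj₂ (β , β<0 , λ { P cl (_ ∷ ps) → refutes P cl ps })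

fourierMotzkin : ∀ N (S : List (Ineq N)) → Feasible S ⊎ Refutable S
fourierMotzkin zero    S = decide₀ S
fourierMotzkin (suc N) S with fourierMotzkin N (residual (eliminate S))
... | inj₁ feasible   = inj₁ (feasibility-lifts (eliminate S) feasible)
... | inj₂ refutation = inj₂ (refutation-lifts (eliminate S) refutation)

-- Covering and packing programs of a symmetric matrix

Covers : ∀ {n k} → (Vector ℚ n → Vector ℚ k) → Vector ℚ n → Set
Covers L x = (∀ i → 0ℚ ≤ x i) × (∀ e → 1ℚ ≤ L x e)

IsMinimum : ∀ {n k} → (Vector ℚ n → Vector ℚ k) → ℚ → Set
IsMinimum L t = (∃ λ x → Covers L x × sumFin x ≡ t) × (∀ x → Covers L x → t ≤ sumFin x)

IsMinimum⇒IsTauF : ∀ {n k} (H : Hypergraph n k) {L t} →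
  (∀ e x → edgeWeight (H e) x ≡ L x e) → IsMinimum L t → IsTauF H t
IsMinimum⇒IsTauF H {L} weight≡L ((x , (0≤x , 1≤Lx) , Σx≡t) , minimal) =
  (x , (0≤x , λ e → ≤-trans (1≤Lx e) (≤-reflexive (sym (weight≡L e x)))) , Σx≡t) ,
  λ y (0≤y , 1≤weight) → minimal y (0≤y , λ e → ≤-trans (1≤weight e) (≤-reflexive (weight≡L e y)))

module SymmetricMatrix {m : ℕ} (A : Fin m → Vector ℚ m)
  (A-sym : ∀ u v → A u v ≡ A v u) (A-nonNeg : ∀ u v → 0ℚ ≤ A u v) (A-diag : ∀ v → A v v ≡ 1ℚ)
  where

  A⊙_ : Vector ℚ m → Vector ℚ m
  (A⊙ x) v = A v · x

  A⊙-selfAdjoint : ∀ u w → u · (A⊙ w) ≡ w · (A⊙ u)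
  A⊙-selfAdjoint u w = begin
    sumFin (λ v → u v * (A v · w))
      ≡⟨ sumFin-cong (λ v → sym (*-distribˡ-sumFin (u v) (λ i → A v i * w i))) ⟩
    sumFin (λ v → sumFin (λ i → u v * (A v i * w i)))
      ≡⟨ sumFin-comm (λ v i → u v * (A v i * w i)) ⟩
    sumFin (λ i → sumFin (λ v → u v * (A v i * w i)))
      ≡⟨ sumFin-cong (λ i → sumFin-cong (λ v → reorder i v)) ⟩
    sumFin (λ i → sumFin (λ v → w i * (A i v * u v)))
      ≡⟨ sumFin-cong (λ i → *-distribˡ-sumFin (w i) (λ v → A i v * u v)) ⟩
    sumFin (λ i → w i * (A i · u))
      ∎
    where
    open ≡-Reasoning
    reorder : ∀ i v → u v * (A v i * w i) ≡ w i * (A i v * u v)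
    reorder i v = trans (cong (λ a → u v * (a * w i)) (A-sym v i))
      (solve 3 (λ u a w → u :* (a :* w) := w :* (a :* u)) refl (u v) (A i v) (w i))

  weakDuality : ∀ {u w c d} → (∀ i → 0ℚ ≤ u i) → (∀ i → 0ℚ ≤ w i) →
    (∀ v → c ≤ (A⊙ w) v) → (∀ i → (A⊙ u) i ≤ d) → c * sumFin u ≤ d * sumFin w
  weakDuality {u} {w} {c} {d} 0≤u 0≤w c≤Aw Au≤d = begin
    c * sumFin u              ≡⟨ sym (*-distribˡ-sumFin c u) ⟩
    sumFin (λ v → c * u v)    ≡⟨ sumFin-cong (λ v → *-comm c (u v)) ⟩
    sumFin (λ v → u v * c)    ≤⟨ sumFin-mono (λ v → *-monoˡ-≤-≥0 (0≤u v) (c≤Aw v)) ⟩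
    u · (A⊙ w)                ≡⟨ A⊙-selfAdjoint u w ⟩
    w · (A⊙ u)                ≤⟨ sumFin-mono (λ i → *-monoˡ-≤-≥0 (0≤w i) (Au≤d i)) ⟩
    sumFin (λ i → w i * d)    ≡⟨ sumFin-cong (λ i → *-comm (w i) d) ⟩
    sumFin (λ i → d * w i)    ≡⟨ *-distribˡ-sumFin d w ⟩
    d * sumFin w              ∎
    where open ≤-Reasoning

  term≤A⊙ : ∀ {x} → (∀ i → 0ℚ ≤ x i) → ∀ v → x v ≤ (A⊙ x) v
  term≤A⊙ {x} 0≤x v =
    ≤-trans (≤-reflexive (trans (sym (*-identityˡ (x v))) (cong (_* x v) (sym (A-diag v)))))
      (term≤sumFin (λ j → *-nonNeg (A-nonNeg v j) (0≤x j)) v)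

  A⊙zeros : ∀ i → (A⊙ zeros) i ≡ 0ℚ
  A⊙zeros i = ·zeros (A i)

  A⊙δ : ∀ v i → (A⊙ δ v) i ≡ A v i
  A⊙δ v i = trans (·-comm (A i) (δ v)) (trans (δ· v (A i)) (A-sym i v))

  Packs : Vector ℚ m → Set
  Packs z = (∀ i → 0ℚ ≤ z i) × (∀ v → (A⊙ z) v ≤ 1ℚ)

  packing≤cover : ∀ {x z} → Covers A⊙_ x → Packs z → sumFin z ≤ sumFin x
  packing≤cover {x} {z} (0≤x , 1≤Ax) (0≤z , Az≤1) =
    ≤-trans (≤-reflexive (sym (*-identityˡ (sumFin z))))
      (≤-trans (weakDuality 0≤z 0≤x 1≤Ax Az≤1) (≤-reflexive (*-identityˡ (sumFin x))))

  record DualPair : Set where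
    field
      cover packing : Vector ℚ m
      covers        : Covers A⊙_ cover
      packs         : Packs packing
      cover≤packing : sumFin cover ≤ sumFin packing
  open DualPair

  -- Variables (x, z) ∈ ℚᵐ × ℚᵐ; the constraints say x, z ≥ 0, A x ≥ 1, A z ≤ 1, Σ x ≤ Σ z.
  nonNegᵢ : Fin (m +ℕ m) → Ineq (m +ℕ m)
  nonNegᵢ k = neg (δ k) ≤ᵢ 0ℚ

  coverᵢ packᵢ : Fin m → Ineq (m +ℕ m)
  coverᵢ v = neg (A v V.++ zeros) ≤ᵢ - 1ℚ
  packᵢ  v = (zeros V.++ A v) ≤ᵢ 1ℚ

  balanceᵢ : Ineq (m +ℕ m)
  balanceᵢ = (ones {m} V.++ neg (ones {m})) ≤ᵢ 0ℚ

  system : List (Ineq (m +ℕ m))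
  system = tabulate nonNegᵢ ++ tabulate coverᵢ ++ tabulate packᵢ ++ balanceᵢ ∷ []

  feasible⇒DualPair : Feasible system → DualPair
  feasible⇒DualPair (y , hs) = record
    { cover = x ; packing = z
    ; covers = (λ i → 0≤y (i ↑ˡ m)) ,
        λ v → ≤-trans (Holds-neg (A v V.++ zeros) (All.tabulate⁻ hCover v)) (≤-reflexive (x-part (A v)))
    ; packs  = (λ i → 0≤y (m ↑ʳ i)) ,
        λ v → ≤-trans (≤-reflexive (sym (z-part (A v)))) (All.tabulate⁻ hPack v)
    ; cover≤packing = p-q≤0⇒p≤q (≤-trans (≤-reflexive (sym balance)) (All.head hBalance))
    }
    where
    x z : Vector ℚ m
    x = y ∘ (_↑ˡ m)
    z = y ∘ (m ↑ʳ_)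
    hRest₁   = All.++⁻ʳ (tabulate nonNegᵢ) hs
    hRest₂   = All.++⁻ʳ (tabulate coverᵢ) hRest₁
    hNonNeg  = All.++⁻ˡ (tabulate nonNegᵢ) hs
    hCover   = All.++⁻ˡ (tabulate coverᵢ) hRest₁
    hPack    = All.++⁻ˡ (tabulate packᵢ) hRest₂
    hBalance = All.++⁻ʳ (tabulate packᵢ) hRest₂
    Holds-neg : ∀ a {b} → Holds y (neg a ≤ᵢ - b) → b ≤ a · y
    Holds-neg a h = neg-cancel-≤ (≤-trans (≤-reflexive (sym (·-neg a y))) h)
    0≤y : ∀ k → 0ℚ ≤ y k
    0≤y k = ≤-trans (Holds-neg (δ k) (All.tabulate⁻ hNonNeg k)) (≤-reflexive (δ· k y))
    x-part : ∀ a → (a V.++ zeros) · y ≡ a · x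
    x-part a = trans (·-++ a zeros y) (trans (cong (a · x +_) (zeros· z)) (+-identityʳ (a · x)))
    z-part : ∀ b → (zeros V.++ b) · y ≡ b · z
    z-part b = trans (·-++ zeros b y) (trans (cong (_+ b · z) (zeros· x)) (+-identityˡ (b · z)))
    balance : coeffs balanceᵢ · y ≡ sumFin x - sumFin z
    balance = trans (·-++ {m} ones (neg ones) y)
      (cong₂ _+_ (ones· x) (trans (·-neg ones z) (cong -_ (ones· z))))

  -- An inference-closed invariant of `system` that weak duality rules out for 0 ≤ β < 0.
  record DualWitness (c : Ineq (m +ℕ m)) : Set where
    field
      μ     : ℚ
      u w   : Vector ℚ m
      0≤μ   : 0ℚ ≤ μ
      0≤u   : ∀ i → 0ℚ ≤ u i
      0≤w   : ∀ i → 0ℚ ≤ w i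
      left  : ∀ i → coeffs c (i ↑ˡ m) + (A⊙ u) i ≤ μ
      right : ∀ i → coeffs c (m ↑ʳ i) + μ ≤ (A⊙ w) i
      total : sumFin w ≤ bound c + sumFin u
  open DualWitness

  ⊕-witness : ∀ {c d} → DualWitness c → DualWitness d → DualWitness (c ⊕ d)
  ⊕-witness {c} {d} P Q = record
    { μ = μ P + μ Q ; u = λ i → u P i + u Q i ; w = λ i → w P i + w Q i
    ; 0≤μ = +-mono-≤ (0≤μ P) (0≤μ Q)
    ; 0≤u = λ i → +-mono-≤ (0≤u P i) (0≤u Q i)
    ; 0≤w = λ i → +-mono-≤ (0≤w P i) (0≤w Q i)
    ; left = λ i → ≤-trans
        (≤-reflexive (trans (cong (coeffs c (i ↑ˡ m) + coeffs d (i ↑ˡ m) +_) (·-distribˡ-+ (A i) (u P) (u Q)))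
                            (interchange (coeffs c (i ↑ˡ m)) (coeffs d (i ↑ˡ m)) ((A⊙ u P) i) ((A⊙ u Q) i))))
        (+-mono-≤ (left P i) (left Q i))
    ; right = λ i → ≤-trans
        (≤-reflexive (interchange (coeffs c (m ↑ʳ i)) (coeffs d (m ↑ʳ i)) (μ P) (μ Q)))
        (≤-trans (+-mono-≤ (right P i) (right Q i)) (≤-reflexive (sym (·-distribˡ-+ (A i) (w P) (w Q)))))
    ; total = ≤-trans (≤-reflexive (sumFin-+ (w P) (w Q)))
        (≤-trans (+-mono-≤ (total P) (total Q))
        (≤-reflexive (trans (interchange (bound c) (sumFin (u P)) (bound d) (sumFin (u Q)))
                            (cong (bound c + bound d +_) (sym (sumFin-+ (u P) (u Q)))))))
    }

  ⊛-witness : ∀ {q c} → 0ℚ ≤ q → DualWitness c → DualWitness (q ⊛ c)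
  ⊛-witness {q} {c} 0≤q P = record
    { μ = q * μ P ; u = λ i → q * u P i ; w = λ i → q * w P i
    ; 0≤μ = *-nonNeg 0≤q (0≤μ P)
    ; 0≤u = λ i → *-nonNeg 0≤q (0≤u P i)
    ; 0≤w = λ i → *-nonNeg 0≤q (0≤w P i)
    ; left = λ i → ≤-trans
        (≤-reflexive (trans (cong (q * coeffs c (i ↑ˡ m) +_) (·-scaleʳ q (A i) (u P)))
                            (sym (*-distribˡ-+ q (coeffs c (i ↑ˡ m)) ((A⊙ u P) i)))))
        (*-monoˡ-≤-≥0 0≤q (left P i))
    ; right = λ i → ≤-trans (≤-reflexive (sym (*-distribˡ-+ q (coeffs c (m ↑ʳ i)) (μ P))))
        (≤-trans (*-monoˡ-≤-≥0 0≤q (right P i)) (≤-reflexive (sym (·-scaleʳ q (A i) (w P)))))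
    ; total = ≤-trans (≤-reflexive (*-distribˡ-sumFin q (w P)))
        (≤-trans (*-monoˡ-≤-≥0 0≤q (total P))
        (≤-reflexive (trans (*-distribˡ-+ q (bound c) (sumFin (u P)))
                            (cong (q * bound c +_) (sym (*-distribˡ-sumFin q (u P)))))))
    }

  weaken-witness : ∀ {c d} → coeffs c ≗ coeffs d → bound c ≤ bound d → DualWitness c → DualWitness d
  weaken-witness c≗d b≤b′ P = record
    { μ = μ P ; u = u P ; w = w P ; 0≤μ = 0≤μ P ; 0≤u = 0≤u P ; 0≤w = 0≤w P
    ; left  = λ i → ≤-trans (≤-reflexive (cong (_+ (A⊙ u P) i) (sym (c≗d (i ↑ˡ m))))) (left P i)
    ; right = λ i → ≤-trans (≤-reflexive (cong (_+ μ P) (sym (c≗d (m ↑ʳ i))))) (right P i)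
    ; total = ≤-trans (total P) (+-monoˡ-≤ (sumFin (u P)) b≤b′)
    }

  dualWitness-closed : ClosedUnderInference DualWitness
  dualWitness-closed = record { ⊕-closed = ⊕-witness ; ⊛-closed = ⊛-witness ; weaken = weaken-witness }

  zeroWitness : ∀ {c} μ → 0ℚ ≤ μ → (∀ i → coeffs c (i ↑ˡ m) ≤ μ) →
    (∀ i → coeffs c (m ↑ʳ i) + μ ≤ 0ℚ) → 0ℚ ≤ bound c → DualWitness c
  zeroWitness {c} μ 0≤μ cL≤μ cR+μ≤0 0≤b = record
    { μ = μ ; u = zeros ; w = zeros ; 0≤μ = 0≤μ ; 0≤u = λ _ → ≤-refl ; 0≤w = λ _ → ≤-refl
    ; left  = λ i → ≤-trans
        (≤-reflexive (trans (cong (coeffs c (i ↑ˡ m) +_) (A⊙zeros i)) (+-identityʳ _))) (cL≤μ i)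
    ; right = λ i → ≤-trans (cR+μ≤0 i) (≤-reflexive (sym (A⊙zeros i)))
    ; total = ≤-trans (≤-reflexive (sumFin-zeros {m}))
        (≤-trans 0≤b (≤-reflexive (sym (trans (cong (bound c +_) (sumFin-zeros {m})) (+-identityʳ (bound c))))))
    }

  nonNeg-witness : ∀ k → DualWitness (nonNegᵢ k)
  nonNeg-witness k = zeroWitness 0ℚ ≤-refl
    (λ i → neg-antimono-≤ (δ-nonNeg k (i ↑ˡ m)))
    (λ i → ≤-trans (≤-reflexive (+-identityʳ _)) (neg-antimono-≤ (δ-nonNeg k (m ↑ʳ i))))
    ≤-refl

  balance-witness : DualWitness balanceᵢ
  balance-witness = zeroWitness 1ℚ (<⇒≤ (positive⁻¹ 1ℚ))
    (λ i → ≤-reflexive (lookup-++ˡ ones (neg ones) i))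
    (λ i → ≤-reflexive (trans (cong (_+ 1ℚ) (lookup-++ʳ {m = m} ones (neg ones) i)) (+-inverseˡ 1ℚ)))
    ≤-refl

  cover-witness : ∀ v → DualWitness (coverᵢ v)
  cover-witness v = record
    { μ = 0ℚ ; u = δ v ; w = zeros ; 0≤μ = ≤-refl ; 0≤u = δ-nonNeg v ; 0≤w = λ _ → ≤-refl
    ; left  = λ i → ≤-reflexive
        (trans (cong₂ (λ a b → - a + b) (lookup-++ˡ (A v) zeros i) (A⊙δ v i)) (+-inverseˡ (A v i)))
    ; right = λ i → ≤-reflexive
        (trans (cong (λ a → - a + 0ℚ) (lookup-++ʳ {m = m} (A v) zeros i)) (sym (A⊙zeros i)))
    ; total = ≤-reflexive
        (trans (sumFin-zeros {m}) (sym (trans (cong (- 1ℚ +_) (sumFin-δ v)) (+-inverseˡ 1ℚ))))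
    }

  pack-witness : ∀ v → DualWitness (packᵢ v)
  pack-witness v = record
    { μ = 0ℚ ; u = zeros ; w = δ v ; 0≤μ = ≤-refl ; 0≤u = λ _ → ≤-refl ; 0≤w = δ-nonNeg v
    ; left  = λ i → ≤-reflexive
        (trans (cong₂ _+_ (lookup-++ˡ zeros (A v) i) (A⊙zeros i)) (+-identityʳ 0ℚ))
    ; right = λ i → ≤-reflexive (trans (cong (_+ 0ℚ) (lookup-++ʳ {m = m} zeros (A v) i))
        (trans (+-identityʳ (A v i)) (sym (A⊙δ v i))))
    ; total = ≤-reflexive
        (trans (sumFin-δ v) (sym (trans (cong (1ℚ +_) (sumFin-zeros {m})) (+-identityʳ 1ℚ))))
    }

  system-witnessed : All DualWitness system
  system-witnessed = All.++⁺ (All.tabulate⁺ nonNeg-witness) (All.++⁺ (All.tabulate⁺ cover-witness)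
    (All.++⁺ (All.tabulate⁺ pack-witness) (balance-witness ∷ [])))

  no-witness : ∀ {β} → β < 0ℚ → ¬ DualWitness (zeros ≤ᵢ β)
  no-witness {β} β<0 W = <-irrefl refl (<-≤-trans Σw<Σu Σu≤Σw)
    where
    Σu Σw : ℚ
    Σu = sumFin (u W)
    Σw = sumFin (w W)
    Σw<Σu : Σw < Σu
    Σw<Σu = ≤-<-trans (total W) (<-≤-trans (+-monoˡ-< Σu β<0) (≤-reflexive (+-identityˡ Σu)))
    Au≤μ : ∀ i → (A⊙ u W) i ≤ μ W
    Au≤μ i = ≤-trans (≤-reflexive (sym (+-identityˡ _))) (left W i)
    μ≤Aw : ∀ i → μ W ≤ (A⊙ w W) i
    μ≤Aw i = ≤-trans (≤-reflexive (sym (+-identityˡ (μ W)))) (right W i)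
    Σu≤Σw : Σu ≤ Σw
    Σu≤Σw with μ W ≤? 0ℚ
    ... | yes μ≤0 = ≤-trans (sumFin-mono (λ i → ≤-trans (term≤A⊙ (0≤u W) i) (≤-trans (Au≤μ i) μ≤0)))
                   (≤-trans (≤-reflexive (sumFin-zeros {m})) (sumFin-nonNeg (0≤w W)))
    ... | no μ≰0  = *-cancelˡ-≤-pos (μ W) {{positive (≰⇒> μ≰0)}}
                   (weakDuality (0≤u W) (0≤w W) μ≤Aw Au≤μ)

  strongDuality : DualPair
  strongDuality with fourierMotzkin _ system
  ... | inj₁ feasible               = feasible⇒DualPair feasible
  ... | inj₂ (β , β<0 , refutation) =
    ⊥-elim (no-witness β<0 (refutation DualWitness dualWitness-closed system-witnessed))

  packing≡cover : (P : DualPair) → sumFin (packing P) ≡ sumFin (cover P)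
  packing≡cover P = ≤-antisym (packing≤cover (covers P) (packs P)) (cover≤packing P)

  cover-minimum : (P : DualPair) → IsMinimum A⊙_ (sumFin (cover P))
  cover-minimum P = (cover P , covers P , refl) ,
    λ x x-covers → ≤-trans (cover≤packing P) (packing≤cover x-covers (packs P))

  Ā⊙_ : Vector ℚ m → Vector ℚ m
  (Ā⊙ y) v = sumFin y - (A⊙ y) v

  cover-cocover : ∀ {x y} → Covers A⊙_ x → Covers Ā⊙_ y → sumFin x ≤ (sumFin x - 1ℚ) * sumFin y
  cover-cocover {x} {y} (0≤x , 1≤Ax) (0≤y , 1≤Āy) = begin
    sumFin x                           ≡⟨ sumFin-cong (λ v → sym (*-identityʳ (x v))) ⟩
    sumFin (λ v → x v * 1ℚ)            ≤⟨ sumFin-mono (λ v → *-monoˡ-≤-≥0 (0≤x v) (1≤Āy v)) ⟩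
    x · (Ā⊙ y)                         ≡⟨ ·-const-minus x (A⊙ y) (sumFin y) ⟩
    sumFin y * sumFin x - x · (A⊙ y)   ≡⟨ cong (λ t → sumFin y * sumFin x - t) (A⊙-selfAdjoint x y) ⟩
    sumFin y * sumFin x - y · (A⊙ x)   ≤⟨ +-monoʳ-≤ (sumFin y * sumFin x) (neg-antimono-≤ Σy≤y·Ax) ⟩
    sumFin y * sumFin x - sumFin y
      ≡⟨ solve 2 (λ s t → s :* t :- s := (t :- con 1ℚ) :* s) refl (sumFin y) (sumFin x) ⟩
    (sumFin x - 1ℚ) * sumFin y         ∎
    where
    open ≤-Reasoning
    Σy≤y·Ax : sumFin y ≤ y · (A⊙ x)
    Σy≤y·Ax = ≤-trans (≤-reflexive (sumFin-cong (λ i → sym (*-identityʳ (y i)))))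
      (sumFin-mono (λ i → *-monoˡ-≤-≥0 (0≤y i) (1≤Ax i)))

  packing-cocovers : ∀ {z k} → Packs z → 0ℚ ≤ k → k * (sumFin z - 1ℚ) ≡ 1ℚ →
    Covers Ā⊙_ (λ i → k * z i)
  packing-cocovers {z} {k} (0≤z , Az≤1) 0≤k k[Σz-1]≡1 = (λ i → *-nonNeg 0≤k (0≤z i)) , λ v → begin
    1ℚ
      ≡⟨ sym k[Σz-1]≡1 ⟩
    k * (sumFin z - 1ℚ)
      ≤⟨ *-monoˡ-≤-≥0 0≤k (+-monoʳ-≤ (sumFin z) (neg-antimono-≤ (Az≤1 v))) ⟩
    k * (sumFin z - (A⊙ z) v)
      ≡⟨ *-distribˡ-+ k (sumFin z) (- (A⊙ z) v) ⟩
    k * sumFin z + k * - (A⊙ z) v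
      ≡⟨ cong₂ _+_ (sym (*-distribˡ-sumFin k z)) (sym (neg-distribʳ-* k ((A⊙ z) v))) ⟩
    sumFin (λ i → k * z i) - k * (A⊙ z) v
      ≡⟨ cong (λ t → sumFin (λ i → k * z i) - t) (sym (·-scaleʳ k (A v) z)) ⟩
    (Ā⊙ (λ i → k * z i)) v
      ∎
    where open ≤-Reasoning

  cocover-minimum : (P : DualPair) → ∀ {k} → 0ℚ < k → k * (sumFin (cover P) - 1ℚ) ≡ 1ℚ →
    IsMinimum Ā⊙_ (k * sumFin (cover P))
  cocover-minimum P {k} 0<k k[a-1]≡1 =
    (y , packing-cocovers (packs P) (<⇒≤ 0<k) k[Σz-1]≡1 , Σy≡ka) , minimal
    where
    a : ℚ
    a = sumFin (cover P)
    y : Vector ℚ m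
    y i = k * packing P i
    k[Σz-1]≡1 : k * (sumFin (packing P) - 1ℚ) ≡ 1ℚ
    k[Σz-1]≡1 = trans (cong (λ t → k * (t - 1ℚ)) (packing≡cover P)) k[a-1]≡1
    Σy≡ka : sumFin y ≡ k * a
    Σy≡ka = trans (*-distribˡ-sumFin k (packing P)) (cong (k *_) (packing≡cover P))
    minimal : ∀ y′ → Covers Ā⊙_ y′ → k * a ≤ sumFin y′
    minimal y′ y′-covers = begin
      k * a                       ≤⟨ *-monoˡ-≤-≥0 (<⇒≤ 0<k) (cover-cocover (covers P) y′-covers) ⟩
      k * ((a - 1ℚ) * sumFin y′)  ≡⟨ sym (*-assoc k (a - 1ℚ) (sumFin y′)) ⟩
      k * (a - 1ℚ) * sumFin y′    ≡⟨ cong (_* sumFin y′) k[a-1]≡1 ⟩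
      1ℚ * sumFin y′              ≡⟨ *-identityˡ (sumFin y′) ⟩
      sumFin y′                   ∎
      where open ≤-Reasoning

-- Neighbourhood programs of a graph

𝟙-if : ∀ b y → (if b then y else 0ℚ) ≡ 𝟙 b * y
𝟙-if true  y = sym (*-identityˡ y)
𝟙-if false y = sym (*-zeroˡ y)

𝟙-not : ∀ b → 𝟙 (not b) ≡ 1ℚ - 𝟙 b
𝟙-not true  = sym (+-inverseʳ 1ℚ)
𝟙-not false = refl

𝟙-nonNeg : ∀ b → 0ℚ ≤ 𝟙 b
𝟙-nonNeg true  = <⇒≤ (positive⁻¹ 1ℚ)
𝟙-nonNeg false = ≤-refl

𝟙≤1 : ∀ b → 𝟙 b ≤ 1ℚ
𝟙≤1 true  = ≤-refl
𝟙≤1 false = <⇒≤ (positive⁻¹ 1ℚ)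

edgeWeight-𝟙 : ∀ {n} (e : Fin n → Bool) x → edgeWeight e x ≡ (λ u → 𝟙 (e u)) · x
edgeWeight-𝟙 e x = sumFin-cong (λ u → 𝟙-if (e u) (x u))

module NeighbourhoodLP {n} (G : Graph n) where

  closedNbhd-sym : ∀ v u → closedNbhd G v u ≡ closedNbhd G u v
  closedNbhd-sym v u with u ≟ v | v ≟ u
  ... | yes _   | yes _   = refl
  ... | yes u≡v | no  v≢u = contradiction (sym u≡v) v≢u
  ... | no  u≢v | yes v≡u = contradiction (sym v≡u) u≢v
  ... | no  _   | no  _   = adj-sym G v u

  closedNbhd-refl : ∀ v → closedNbhd G v v ≡ true
  closedNbhd-refl v with v ≟ v
  ... | yes _   = refl
  ... | no  v≢v = contradiction refl v≢v

  closedNbhd-false : ∀ {u w} → ¬ u ≡ w → adj G u w ≡ false → closedNbhd G u w ≡ false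
  closedNbhd-false {u} {w} u≢w u≁w with w ≟ u
  ... | yes w≡u = contradiction (sym w≡u) u≢w
  ... | no  _   = u≁w

  openNbhd-complement : ∀ v u → openNbhd (complement G) v u ≡ not (closedNbhd G v u)
  openNbhd-complement v u with v ≟ u | u ≟ v
  ... | yes _   | yes _   = refl
  ... | yes v≡u | no  u≢v = contradiction (sym v≡u) u≢v
  ... | no  v≢u | yes u≡v = contradiction (sym u≡v) v≢u
  ... | no  _   | no  _   = refl

  A : Fin n → Vector ℚ n
  A v u = 𝟙 (closedNbhd G v u)

  open SymmetricMatrix A (λ v u → cong 𝟙 (closedNbhd-sym v u)) (λ v u → 𝟙-nonNeg (closedNbhd G v u))
    (λ v → cong 𝟙 (closedNbhd-refl v)) public

  edgeWeight-closedNbhd : ∀ v x → edgeWeight (closedNbhd G v) x ≡ (A⊙ x) v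
  edgeWeight-closedNbhd v x = edgeWeight-𝟙 (closedNbhd G v) x

  edgeWeight-complement : ∀ v y → edgeWeight (openNbhd (complement G) v) y ≡ (Ā⊙ y) v
  edgeWeight-complement v y = begin
    edgeWeight (openNbhd (complement G) v) y
      ≡⟨ edgeWeight-𝟙 (openNbhd (complement G) v) y ⟩
    (λ u → 𝟙 (openNbhd (complement G) v u)) · y
      ≡⟨ sumFin-cong (λ u → cong (λ b → 𝟙 b * y u) (openNbhd-complement v u)) ⟩
    (λ u → 𝟙 (not (closedNbhd G v u))) · y
      ≡⟨ sumFin-cong (λ u → cong (_* y u) (𝟙-not (closedNbhd G v u))) ⟩
    (λ u → 1ℚ - A v u) · y
      ≡⟨ ·-comm (λ u → 1ℚ - A v u) y ⟩
    y · (λ u → 1ℚ - A v u)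
      ≡⟨ ·-const-minus y (A v) 1ℚ ⟩
    1ℚ * sumFin y - y · A v
      ≡⟨ cong₂ _-_ (*-identityˡ (sumFin y)) (·-comm y (A v)) ⟩
    (Ā⊙ y) v
      ∎
    where open ≡-Reasoning

  A⊙≤sum : ∀ {x} → (∀ i → 0ℚ ≤ x i) → ∀ v → (A⊙ x) v ≤ sumFin x
  A⊙≤sum {x} 0≤x v = sumFin-mono λ u →
    ≤-trans (*-monoʳ-≤-nonNeg (x u) {{nonNegative (0≤x u)}} (𝟙≤1 (closedNbhd G v u)))
      (≤-reflexive (*-identityˡ (x u)))

  nonNeighbour≤Ā⊙ : ∀ {x u w} → (∀ i → 0ℚ ≤ x i) → closedNbhd G u w ≡ false → x w ≤ (Ā⊙ x) u
  nonNeighbour≤Ā⊙ {x} {u} {w} 0≤x u≁w = begin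
    x w
      ≡⟨ sym (*-identityˡ (x w)) ⟩
    𝟙 (not false) * x w
      ≡⟨ cong (λ b → 𝟙 b * x w) (sym (trans (openNbhd-complement u w) (cong not u≁w))) ⟩
    𝟙 (openNbhd (complement G) u w) * x w
      ≤⟨ term≤sumFin (λ j → *-nonNeg (𝟙-nonNeg (openNbhd (complement G) u j)) (0≤x j)) w ⟩
    (λ j → 𝟙 (openNbhd (complement G) u j)) · x
      ≡⟨ sym (edgeWeight-𝟙 (openNbhd (complement G) u) x) ⟩
    edgeWeight (openNbhd (complement G) u) x
      ≡⟨ edgeWeight-complement u x ⟩
    (Ā⊙ x) u
      ∎
    where open ≤-Reasoning

  covers⇒1<sum : Fin n → (∀ v → ¬ Universal G v) → ∀ {x} → Covers A⊙_ x → 1ℚ < sumFin x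
  covers⇒1<sum v₀ no-universal {x} (0≤x , 1≤Ax) with 1ℚ <? sumFin x
  ... | yes 1<Σx = 1<Σx
  ... | no  1≮Σx = ⊥-elim (no-universal w universal)
    where
    0<Σx : 0ℚ < sumFin x
    0<Σx = <-≤-trans (positive⁻¹ 1ℚ) (≤-trans (1≤Ax v₀) (A⊙≤sum 0≤x v₀))
    w = proj₁ (∃-positive-term x 0<Σx)
    0<xw = proj₂ (∃-positive-term x 0<Σx)
    neighbour : ∀ u → closedNbhd G u w ≡ false → ⊥
    neighbour u u≁w = <-irrefl refl (<-≤-trans 0<xw (≤-trans (nonNeighbour≤Ā⊙ 0≤x u≁w)
      (≤-trans (+-mono-≤ (≮⇒≥ 1≮Σx) (neg-antimono-≤ (1≤Ax u))) (≤-reflexive (+-inverseʳ 1ℚ)))))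
    universal : Universal G w
    universal u u≢w with adj G w u in w~u
    ... | true  = refl
    ... | false = ⊥-elim (neighbour u (closedNbhd-false u≢w (trans (adj-sym G u w) w~u)))

reciprocal-sum : ∀ {a b} .{{_ : NonZero a}} .{{_ : NonZero b}} → a + b ≡ a * b → 1/ a + 1/ b ≡ 1ℚ
reciprocal-sum {a} {b} a+b≡ab = begin
  1/ a + 1/ b
    ≡⟨ cong₂ _+_ (sym (trans (cong (1/ a *_) (*-inverseʳ b)) (*-identityʳ (1/ a))))
                 (sym (trans (cong (1/ b *_) (*-inverseʳ a)) (*-identityʳ (1/ b)))) ⟩
  1/ a * (b * 1/ b) + 1/ b * (a * 1/ a)
    ≡⟨ solve 4 (λ a b p r → p :* (b :* r) :+ r :* (a :* p) := p :* r :* (a :+ b)) refl a b (1/ a) (1/ b) ⟩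
  1/ a * 1/ b * (a + b)
    ≡⟨ cong (1/ a * 1/ b *_) a+b≡ab ⟩
  1/ a * 1/ b * (a * b)
    ≡⟨ solve 4 (λ a b p r → p :* r :* (a :* b) := (a :* p) :* (b :* r)) refl a b (1/ a) (1/ b) ⟩
  (a * 1/ a) * (b * 1/ b)
    ≡⟨ cong₂ _*_ (*-inverseʳ a) (*-inverseʳ b) ⟩
  1ℚ
    ∎
  where open ≡-Reasoning

a+ka≡a*ka : ∀ {a k} → k * (a - 1ℚ) ≡ 1ℚ → a + k * a ≡ a * (k * a)
a+ka≡a*ka {a} {k} k[a-1]≡1 = begin
  a + k * a               ≡⟨ solve 2 (λ a k → a :+ k :* a := a :* (con 1ℚ :+ k)) refl a k ⟩
  a * (1ℚ + k)            ≡⟨ cong (λ t → a * (t + k)) (sym k[a-1]≡1) ⟩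
  a * (k * (a - 1ℚ) + k)  ≡⟨ solve 2 (λ a k → a :* (k :* (a :- con 1ℚ) :+ k) := a :* (k :* a)) refl a k ⟩
  a * (k * a)             ∎
  where open ≡-Reasoning

corollary2 : (n : ℕ) (G : Graph (suc n)) → (∀ v → ¬ Universal G v) →
    Σ ℚ (λ a → Σ ℚ (λ b →
      IsFracDom G a × IsFracTotalDom (complement G) b ×
      Σ (NonZero a) (λ nza → Σ (NonZero b) (λ nzb →
        ((1/ a) {{nza}}) + ((1/ b) {{nzb}}) ≡ 1ℚ))))
corollary2 n G no-universal =
  a , k * a ,
  IsMinimum⇒IsTauF (closedNbhd G) edgeWeight-closedNbhd (cover-minimum P) ,
  IsMinimum⇒IsTauF (openNbhd (complement G)) edgeWeight-complement (cocover-minimum P 0<k k[a-1]≡1) ,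
  nonZero-a , nonZero-ka ,
  reciprocal-sum {a} {k * a} {{nonZero-a}} {{nonZero-ka}} (a+ka≡a*ka {a} {k} k[a-1]≡1)
  where
  open NeighbourhoodLP G
  P : DualPair
  P = strongDuality
  a : ℚ
  a = sumFin (DualPair.cover P)
  1<a : 1ℚ < a
  1<a = covers⇒1<sum zero no-universal (DualPair.covers P)
  0<a : 0ℚ < a
  0<a = <-trans (positive⁻¹ 1ℚ) 1<a
  inverse : ∃ λ k → 0ℚ < k × k * (a - 1ℚ) ≡ 1ℚ
  inverse = positive-inverse (≤-<-trans (≤-reflexive (sym (+-inverseʳ 1ℚ))) (+-monoˡ-< (- 1ℚ) 1<a))
  k : ℚ
  k = proj₁ inverse
  0<k : 0ℚ < k
  0<k = proj₁ (proj₂ inverse)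
  k[a-1]≡1 : k * (a - 1ℚ) ≡ 1ℚ
  k[a-1]≡1 = proj₂ (proj₂ inverse)
  nonZero-a : NonZero a
  nonZero-a = pos⇒nonZero a {{positive 0<a}}
  nonZero-ka : NonZero (k * a)
  nonZero-ka = pos⇒nonZero (k * a) {{pos*pos⇒pos k {{positive 0<k}} a {{positive 0<a}}}}
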